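{- For wheel graphs, $\mathrm{nim}(\mathrm{DNG}(W_{n}))=\mathrm{pty}(n)$.
   Context: For $n\ge 5$, the wheel graph $W_n$ is the join $K_1+C_{n-1}$ of a central vertex with a cycle on $n-1$ vertices. For a graph $G=(V,E)$, a set of vertices is geodetically convex if it contains every vertex on every shortest path between two of its vertices; the convex hull $[P]$ is the smallest convex set containing $P$, and $P$ is generating if $[P]=V$. In the avoidance game $\mathrm{DNG}(G)$, two players alternately select previously-unselected vertices such that the selected set never generates; the player who cannot move loses. $\mathrm{nim}$ denotes the nim-number of an impartial game, and $\mathrm{pty}(n):=n\bmod 2$. -}

module Defs where

open import Data.Nat using (ℕ; zero; suc; _∸_; _<_; _%_)
open import Data.Fin using (Fin; zero; suc; toℕ)
open import Data.Fin.Subset using (Subset; _∈_; _∉_; _⊆_; _∪_; ⁅_⁆; ⊥)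
open import Data.Unit using (⊤)
open import Data.Empty renaming (⊥ to Empty)
open import Data.Product using (Σ; ∃; _×_)
open import Data.Sum using (_⊎_)
open import Relation.Nullary using (¬_)
open import Relation.Binary.PropositionalEquality using (_≡_; _≢_)

Graph : ℕ → Set₁
Graph n = Fin n → Fin n → Set

module _ {n : ℕ} (G : Graph n) where

  data Walk : Fin n → Fin n → ℕ → Set where
    here : ∀ u → Walk u u 0
    step : ∀ {u w v k} → G u w → Walk w v k → Walk u v (suc k)

  data OnWalk (x : Fin n) : ∀ {u v k} → Walk u v k → Set where
    on-here  : OnWalk x (here x)
    on-start : ∀ {w v k} (e : G x w) (p : Walk w v k) → OnWalk x (step e p)
    on-later : ∀ {u w v k} (e : G u w) (p : Walk w v k) → OnWalk x p → OnWalk x (step e p)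

  Shortest : ∀ {u v k} → Walk u v k → Set
  Shortest {u} {v} {k} _ = ∀ m → m < k → ¬ Walk u v m

  Convex : Subset n → Set
  Convex S = ∀ u v k (p : Walk u v k) → u ∈ S → v ∈ S → Shortest p →
             ∀ x → OnWalk x p → x ∈ S

  -- P is generating iff its convex hull [P] (the smallest convex set containing P,
  -- i.e. the intersection of all convex supersets of P) is the whole vertex set:
  -- every convex set containing P contains every vertex.
  Generating : Subset n → Set
  Generating P = ∀ C → Convex C → P ⊆ C → ∀ v → v ∈ C

  -- Moves of the avoidance game DNG(G): from the selected set P, select an unselected
  -- vertex v such that P ∪ {v} is not generating.
  Option : Subset n → Subset n → Set
  Option P Q = Σ (Fin n) λ v → v ∉ P × (Q ≡ P ∪ ⁅ v ⁆) × ¬ Generating Q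

  -- HasNim P k : the position P (set of selected vertices) has nim-number k,
  -- i.e. k = mex { nim(Q) | Q an option of P }:
  -- every j < k is the nim-number of some option, and no option has nim-number k.
  data HasNim (P : Subset n) (k : ℕ) : Set where
    mex : (∀ j → j < k → Σ (Subset n) λ Q → Option P Q × HasNim Q j) →
          (∀ Q → Option P Q → Σ ℕ λ j → HasNim Q j × j ≢ k) →
          HasNim P k

  NimDNG : ℕ → Set
  NimDNG k = HasNim ⊥ k

CycAdj : ℕ → ℕ → ℕ → Set
CycAdj m a b = suc a ≡ b ⊎ suc b ≡ a ⊎ (a ≡ 0 × b ≡ m ∸ 1) ⊎ (b ≡ 0 × a ≡ m ∸ 1)

-- Wheel graph W_n = K_1 + C_{n-1}: vertex zero is the centre, vertices suc i
-- (i = 0, …, n-2) form the cycle C_{n-1}.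
Wheel : (n : ℕ) → Graph n
Wheel n zero    zero    = Empty
Wheel n zero    (suc _) = ⊤
Wheel n (suc _) zero    = ⊤
Wheel n (suc i) (suc j) = CycAdj (n ∸ 1) (toℕ i) (toℕ j)

pty : ℕ → ℕ
pty n = n % 2

{-# OPTIONS --safe #-}
module Submission where

-- A set of vertices of W_n fails to generate exactly when it misses two
-- consecutive rim vertices: the complement of such a pair is convex, while if
-- P meets every rim edge then every rim vertex outside P lies between its two
-- rim neighbours, which are in P, and the centre lies between any two rim
-- vertices at distance two. Since W_n has diameter 2, convexity is just
-- closure under such midpoints. So every non-generating set leaves at least
-- two vertices unselected, and one leaving at least three can be extended
-- while keeping a free rim edge: every play lasts exactly n - 2 moves, and
-- the nim-number of such a game is the parity of its length.

open import Defs
open import Data.Nat using (ℕ; _≤_; zero; suc; _+_; _<_; _%_; z≤n; s≤s; _≟_)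
open import Data.Nat.Properties using (suc-injective; <-irrefl; m≤m+n; ≤-trans; ≤-pred; m≤n⇒∃[o]m+o≡n)
open import Data.Fin using (Fin; zero; suc; toℕ; fromℕ; inject₁; lower₁)
open import Data.Fin.Properties
  using (toℕ-injective; toℕ<n; toℕ-fromℕ; toℕ-inject₁; toℕ-inject₁-≢; toℕ-lower₁; ¬∀⟶∃¬)
  renaming (suc-injective to suc-injectiveᶠ)
open import Data.Fin.Subset using (Subset; _∈_; _∉_; _⊆_; _∪_; ⁅_⁆; ∁; ⊥; inside; outside)
open import Data.Fin.Subset.Properties
  using (_∈?_; ∉⊥; x∈⁅x⁆; x∈⁅y⁆⇒x≡y; x∈∁p⇒x∉p; x∉p⇒x∈∁p; x∈p∪q⁻; x∈p∪q⁺; p⊆p∪q; q⊆p∪q; ∪-identityʳ)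
open import Data.Vec using (_∷_; []; here; there)
open import Data.Unit using (tt)
open import Data.Product using (Σ; _×_; _,_; proj₁; proj₂)
open import Data.Sum using (_⊎_; inj₁; inj₂; [_,_])
open import Function using (_∘_; id)
open import Relation.Nullary using (¬_; yes; no; contradiction)
open import Relation.Nullary.Decidable using (_⊎-dec_)
open import Relation.Binary.PropositionalEquality using (_≡_; _≢_; refl; sym; trans; cong; subst)

parity : ℕ → ℕ
parity zero          = 0
parity (suc zero)    = 1
parity (suc (suc j)) = parity j

parity≡%2 : ∀ j → parity j ≡ j % 2
parity≡%2 zero          = refl
parity≡%2 (suc zero)    = refl
parity≡%2 (suc (suc j)) = parity≡%2 j

parity≢parity-suc : ∀ j → parity j ≢ parity (suc j)
parity≢parity-suc zero          ()
parity≢parity-suc (suc zero)    ()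
parity≢parity-suc (suc (suc j)) = parity≢parity-suc j

<parity-suc⇒≡parity : ∀ {i} j → i < parity (suc j) → i ≡ parity j
<parity-suc⇒≡parity zero          (s≤s z≤n) = refl
<parity-suc⇒≡parity (suc zero)    ()
<parity-suc⇒≡parity (suc (suc j)) i<       = <parity-suc⇒≡parity j i<

unselected : ∀ {p} → Subset p → ℕ
unselected []            = 0
unselected (inside ∷ P)  = unselected P
unselected (outside ∷ P) = suc (unselected P)

unselected-⊥ : ∀ p → unselected (⊥ {p}) ≡ p
unselected-⊥ zero    = refl
unselected-⊥ (suc p) = cong suc (unselected-⊥ p)

∉⇒unselected-∪-⁅⁆ : ∀ {p} (P : Subset p) v → v ∉ P → unselected P ≡ suc (unselected (P ∪ ⁅ v ⁆))
∉⇒unselected-∪-⁅⁆ (inside ∷ P)  zero    v∉P = contradiction here v∉P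
∉⇒unselected-∪-⁅⁆ (outside ∷ P) zero    _   = cong (suc ∘ unselected) (sym (∪-identityʳ P))
∉⇒unselected-∪-⁅⁆ (inside ∷ P)  (suc v) v∉P = ∉⇒unselected-∪-⁅⁆ P v (v∉P ∘ there)
∉⇒unselected-∪-⁅⁆ (outside ∷ P) (suc v) v∉P = cong suc (∉⇒unselected-∪-⁅⁆ P v (v∉P ∘ there))

∉-∪-⁅⁆ : ∀ {p} {P : Subset p} {a b} → b ∉ P → b ≢ a → b ∉ P ∪ ⁅ a ⁆
∉-∪-⁅⁆ {P = P} {a} b∉P b≢a b∈ = [ b∉P , b≢a ∘ x∈⁅y⁆⇒x≡y a ] (x∈p∪q⁻ P ⁅ a ⁆ b∈)

0<unselected⇒∃∉ : ∀ {p} (P : Subset p) → 0 < unselected P → Σ (Fin p) (_∉ P)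
0<unselected⇒∃∉ (outside ∷ P) _ = zero , λ ()
0<unselected⇒∃∉ (inside ∷ P)  0< with 0<unselected⇒∃∉ P 0<
... | v , v∉P = suc v , λ { (there v∈P) → v∉P v∈P }

module _ {p : ℕ} {P : Subset p} {a b : Fin p} (a≢b : a ≢ b) (a∉P : a ∉ P) (b∉P : b ∉ P) where

  private
    R : Subset p
    R = (P ∪ ⁅ a ⁆) ∪ ⁅ b ⁆

    unselected-R : unselected P ≡ 2 + unselected R
    unselected-R = trans (∉⇒unselected-∪-⁅⁆ P a a∉P)
                         (cong suc (∉⇒unselected-∪-⁅⁆ (P ∪ ⁅ a ⁆) b (∉-∪-⁅⁆ b∉P (a≢b ∘ sym))))

  2≤unselected : 2 ≤ unselected P
  2≤unselected = subst (2 ≤_) (sym unselected-R) (m≤m+n 2 _)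

  ∃-third-unselected : 3 ≤ unselected P → Σ (Fin p) λ v → v ∉ P × a ≢ v × b ≢ v
  ∃-third-unselected 3≤ with 0<unselected⇒∃∉ R (≤-pred (≤-pred (subst (3 ≤_) unselected-R 3≤)))
  ... | v , v∉R = v , v∉R ∘ p⊆p∪q ⁅ b ⁆ ∘ p⊆p∪q ⁅ a ⁆
                    , (λ { refl → v∉R (p⊆p∪q ⁅ b ⁆ (q⊆p∪q P ⁅ a ⁆ (x∈⁅x⁆ a))) })
                    , (λ { refl → v∉R (q⊆p∪q (P ∪ ⁅ a ⁆) ⁅ b ⁆ (x∈⁅x⁆ b)) })

module _ {n : ℕ} (G : Graph n) where

  option⇒unselected : ∀ {P Q j} → Option G P Q → unselected P ≡ suc j → unselected Q ≡ j
  option⇒unselected {P} (v , v∉P , refl , _) P≡ =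
    suc-injective (trans (sym (∉⇒unselected-∪-⁅⁆ P v v∉P)) P≡)

  module _ (¬generating⇒2≤unselected : ∀ P → ¬ Generating G P → 2 ≤ unselected P)
           (¬generating⇒extensible : ∀ P → ¬ Generating G P → 3 ≤ unselected P →
                                       Σ (Subset n) (Option G P))
           where

    hasNim-parity : ∀ j P → ¬ Generating G P → unselected P ≡ 2 + j → HasNim G P (parity j)
    hasNim-parity zero P _ P≡2 = mex (λ _ ()) λ Q P→Q@(_ , _ , _ , ¬genQ) →
      contradiction (subst (2 ≤_) (option⇒unselected P→Q P≡2) (¬generating⇒2≤unselected Q ¬genQ))
                    (<-irrefl refl)
    hasNim-parity (suc j) P ¬genP P≡3+j = mex smaller options
      where
      hasNim-option : ∀ {Q} → Option G P Q → HasNim G Q (parity j)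
      hasNim-option P→Q@(_ , _ , _ , ¬genQ) = hasNim-parity j _ ¬genQ (option⇒unselected P→Q P≡3+j)

      options : ∀ Q → Option G P Q → Σ ℕ λ i → HasNim G Q i × i ≢ parity (suc j)
      options Q P→Q = parity j , hasNim-option P→Q , parity≢parity-suc j

      smaller : ∀ i → i < parity (suc j) → Σ (Subset n) λ Q → Option G P Q × HasNim G Q i
      smaller i i< with ¬generating⇒extensible P ¬genP (subst (3 ≤_) (sym P≡3+j) (m≤m+n 3 j))
      ... | Q , P→Q =
        Q , P→Q , subst (HasNim G Q) (sym (<parity-suc⇒≡parity j i<)) (hasNim-option P→Q)

module _ {n : ℕ} (G : Graph n) where

  Between : Fin n → Fin n → Fin n → Set
  Between u w v = G u w × G w v × u ≢ v × ¬ G u v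

  BetweenClosed : Subset n → Set
  BetweenClosed C = ∀ {u w v} → u ∈ C → v ∈ C → Between u w v → w ∈ C

  convex⇒betweenClosed : ∀ {C} → Convex G C → BetweenClosed C
  convex⇒betweenClosed convex {u} {w} {v} u∈C v∈C (uw , wv , u≢v , ¬uv) =
    convex u v 2 (step uw (step wv (here v))) u∈C v∈C shorter w (on-later uw _ (on-start wv (here v)))
    where
    shorter : ∀ j → j < 2 → ¬ Walk G u v j
    shorter zero       _ (here _)           = u≢v refl
    shorter (suc zero) _ (step uv (here _)) = ¬uv uv
    shorter (suc (suc _)) (s≤s (s≤s ()))

  betweenClosed⇒convex : (∀ u v → Σ ℕ λ j → j ≤ 2 × Walk G u v j) →
                         ∀ {C} → BetweenClosed C → Convex G C
  betweenClosed⇒convex diameter≤2 {C} closed u v _ p u∈C v∈C = on p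
    where
    on : ∀ {k} (p : Walk G u v k) → Shortest G p → ∀ x → OnWalk G x p → x ∈ C
    on (here _)                     _        _ on-here                               = u∈C
    on (step _ _)                   _        _ (on-start _ _)                        = u∈C
    on (step _ (here _))            _        _ (on-later _ _ on-here)                = v∈C
    on (step _ (step _ (here _)))   _        _ (on-later _ _ (on-later _ _ on-here)) = v∈C
    on (step uw (step wv (here _))) shortest _ (on-later _ _ (on-start _ _))         =
      closed u∈C v∈C (uw , wv , (λ { refl → shortest 0 (s≤s z≤n) (here u) })
                              , (λ uv → shortest 1 (s≤s (s≤s z≤n)) (step uv (here v))))
    on (step _ (step _ (step _ _))) shortest _ _ with diameter≤2 u v
    ... | j , j≤2 , q = contradiction q (shortest j (s≤s (≤-trans j≤2 (s≤s (s≤s z≤n)))))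

module WheelGame (k : ℕ) where

  m n : ℕ
  m = 4 + k
  n = suc m

  W : Graph n
  W = Wheel n

  CycleStep : ℕ → ℕ → Set
  CycleStep a b = (a ≡ 3 + k × b ≡ 0) ⊎ (a ≢ 3 + k × b ≡ suc a)

  cycleStep-functional : ∀ {a b c} → CycleStep a b → CycleStep a c → b ≡ c
  cycleStep-functional (inj₁ (_ , refl))    (inj₁ (_ , refl))    = refl
  cycleStep-functional (inj₁ (a≡ , _))      (inj₂ (a≢ , _))      = contradiction a≡ a≢
  cycleStep-functional (inj₂ (a≢ , _))      (inj₁ (a≡ , _))      = contradiction a≡ a≢
  cycleStep-functional (inj₂ (_ , refl))    (inj₂ (_ , refl))    = refl

  cycleStep-injective : ∀ {a b c} → CycleStep a c → CycleStep b c → a ≡ b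
  cycleStep-injective (inj₁ (refl , _))    (inj₁ (refl , _))    = refl
  cycleStep-injective (inj₁ (_ , refl))    (inj₂ (_ , ()))
  cycleStep-injective (inj₂ (_ , refl))    (inj₁ (_ , ()))
  cycleStep-injective (inj₂ (_ , refl))    (inj₂ (_ , refl))    = refl

  cycleStep⇒cycAdj : ∀ {a b} → CycleStep a b → CycAdj m a b
  cycleStep⇒cycAdj (inj₁ (a≡ , b≡)) = inj₂ (inj₂ (inj₂ (b≡ , a≡)))
  cycleStep⇒cycAdj (inj₂ (_ , b≡))  = inj₁ (sym b≡)

  cycAdj⇒cycleStep : ∀ {a b} → a < m → b < m → CycAdj m a b → CycleStep a b ⊎ CycleStep b a
  cycAdj⇒cycleStep {a} a<m b<m (inj₁ refl) with a ≟ 3 + k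
  ... | yes refl = contradiction b<m (<-irrefl refl ∘ ≤-pred)
  ... | no a≢    = inj₁ (inj₂ (a≢ , refl))
  cycAdj⇒cycleStep {b = b} a<m b<m (inj₂ (inj₁ refl)) with b ≟ 3 + k
  ... | yes refl = contradiction a<m (<-irrefl refl ∘ ≤-pred)
  ... | no b≢    = inj₂ (inj₂ (b≢ , refl))
  cycAdj⇒cycleStep _ _ (inj₂ (inj₂ (inj₁ (a≡0 , b≡)))) = inj₂ (inj₁ (b≡ , a≡0))
  cycAdj⇒cycleStep _ _ (inj₂ (inj₂ (inj₂ (b≡0 , a≡)))) = inj₁ (inj₁ (a≡ , b≡0))

  cycleStep-irrefl : ∀ {a b} → CycleStep a b → b ≢ a
  cycleStep-irrefl (inj₁ (refl , refl)) ()
  cycleStep-irrefl (inj₂ (_ , refl))    ()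

  cycleStep²-irrefl : ∀ {a b c} → CycleStep a b → CycleStep b c → c ≢ a
  cycleStep²-irrefl (inj₁ (refl , refl)) (inj₁ (() , _))
  cycleStep²-irrefl (inj₁ (refl , refl)) (inj₂ (_ , refl)) ()
  cycleStep²-irrefl (inj₂ (_ , refl))    (inj₁ (() , refl)) refl
  cycleStep²-irrefl (inj₂ (_ , refl))    (inj₂ (_ , refl)) ()

  cycleStep³-irrefl : ∀ {a b c d} → CycleStep a b → CycleStep b c → CycleStep c d → d ≢ a
  cycleStep³-irrefl (inj₁ (refl , refl)) (inj₁ (() , _))     _
  cycleStep³-irrefl (inj₁ (refl , refl)) (inj₂ (_ , refl))   (inj₁ (() , _))
  cycleStep³-irrefl (inj₁ (refl , refl)) (inj₂ (_ , refl))   (inj₂ (_ , refl)) ()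
  cycleStep³-irrefl (inj₂ (_ , refl))    (inj₁ (_ , refl))   (inj₁ (() , _))
  cycleStep³-irrefl (inj₂ (_ , refl))    (inj₁ (() , refl))  (inj₂ (_ , refl)) refl
  cycleStep³-irrefl (inj₂ (_ , refl))    (inj₂ (_ , refl))   (inj₁ (() , refl)) refl
  cycleStep³-irrefl (inj₂ (_ , refl))    (inj₂ (_ , refl))   (inj₂ (_ , refl)) ()

  next : Fin m → Fin m
  next i with toℕ i ≟ 3 + k
  ... | yes _  = zero
  ... | no i≢  = suc (lower₁ i (i≢ ∘ sym))

  cycleStep-next : ∀ i → CycleStep (toℕ i) (toℕ (next i))
  cycleStep-next i with toℕ i ≟ 3 + k
  ... | yes i≡ = inj₁ (i≡ , refl)
  ... | no i≢  = inj₂ (i≢ , cong suc (toℕ-lower₁ i (i≢ ∘ sym)))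

  cycleStep⇒≡next : ∀ {i j} → CycleStep (toℕ i) (toℕ j) → j ≡ next i
  cycleStep⇒≡next {i} i→j = toℕ-injective (cycleStep-functional i→j (cycleStep-next i))

  next-injective : ∀ {i j} → next i ≡ next j → i ≡ j
  next-injective {i} {j} eq = toℕ-injective (cycleStep-injective (cycleStep-next i) j→next-i)
    where
    j→next-i : CycleStep (toℕ j) (toℕ (next i))
    j→next-i = subst (CycleStep (toℕ j) ∘ toℕ) (sym eq) (cycleStep-next j)

  next-surjective : ∀ j → Σ (Fin m) λ i → next i ≡ j
  next-surjective zero    = fromℕ (3 + k) , sym (cycleStep⇒≡next (inj₁ (toℕ-fromℕ (3 + k) , refl)))
  next-surjective (suc j) = inject₁ j ,
    sym (cycleStep⇒≡next (inj₂ (toℕ-inject₁-≢ j ∘ sym , cong suc (sym (toℕ-inject₁ j)))))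

  next-irrefl : ∀ i → next i ≢ i
  next-irrefl i = cycleStep-irrefl (cycleStep-next i) ∘ cong toℕ

  next²-irrefl : ∀ i → next (next i) ≢ i
  next²-irrefl i = cycleStep²-irrefl (cycleStep-next i) (cycleStep-next (next i)) ∘ cong toℕ

  next³-irrefl : ∀ i → next (next (next i)) ≢ i
  next³-irrefl i =
    cycleStep³-irrefl (cycleStep-next i) (cycleStep-next (next i)) (cycleStep-next (next (next i))) ∘ cong toℕ

  rim-adjacent-next : ∀ i → W (suc i) (suc (next i))
  rim-adjacent-next i = cycleStep⇒cycAdj (cycleStep-next i)

  rim-adjacent⇒next : ∀ {i j} → W (suc i) (suc j) → j ≡ next i ⊎ i ≡ next j
  rim-adjacent⇒next {i} {j} ij with cycAdj⇒cycleStep (toℕ<n i) (toℕ<n j) ij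
  ... | inj₁ i→j = inj₁ (cycleStep⇒≡next i→j)
  ... | inj₂ j→i = inj₂ (cycleStep⇒≡next j→i)

  rim-neighbours : ∀ {u j v} → W (suc u) (suc j) → W (suc j) (suc v) → u ≢ v →
                   (u ≡ next j × next v ≡ j) ⊎ (next u ≡ j × v ≡ next j)
  rim-neighbours uj jv u≢v with rim-adjacent⇒next uj | rim-adjacent⇒next jv
  ... | inj₁ j≡ | inj₁ v≡ = inj₂ (sym j≡ , v≡)
  ... | inj₁ j≡ | inj₂ j≡′ = contradiction (next-injective (trans (sym j≡) j≡′)) u≢v
  ... | inj₂ u≡ | inj₁ v≡ = contradiction (trans u≡ (sym v≡)) u≢v
  ... | inj₂ u≡ | inj₂ j≡ = inj₁ (u≡ , sym j≡)

  -- This is where n ≥ 5 enters: on a rim of length 3, i and next (next i) are adjacent.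
  rim-two-apart : ∀ i → suc i ≢ suc (next (next i)) × ¬ W (suc i) (suc (next (next i)))
  rim-two-apart i = (λ eq → next²-irrefl i (sym (suc-injectiveᶠ eq))) , not-adjacent
    where
    not-adjacent : ¬ W (suc i) (suc (next (next i)))
    not-adjacent adj with rim-adjacent⇒next adj
    ... | inj₁ eq = next-irrefl i (next-injective eq)
    ... | inj₂ eq = next³-irrefl i (sym eq)

  rim-between : ∀ i → Between W (suc i) (suc (next i)) (suc (next (next i)))
  rim-between i = rim-adjacent-next i , rim-adjacent-next (next i) , rim-two-apart i

  hub-between : ∀ i → Between W (suc i) zero (suc (next (next i)))
  hub-between i = tt , tt , rim-two-apart i

  wheel-diameter≤2 : ∀ u v → Σ ℕ λ j → j ≤ 2 × Walk W u v j
  wheel-diameter≤2 zero    zero    = 0 , z≤n , here zero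
  wheel-diameter≤2 zero    (suc _) = 1 , s≤s z≤n , step tt (here _)
  wheel-diameter≤2 (suc _) zero    = 1 , s≤s z≤n , step tt (here _)
  wheel-diameter≤2 (suc _) (suc _) = 2 , s≤s (s≤s z≤n) , step {w = zero} tt (step tt (here _))

  module _ (i : Fin m) where

    private
      A B : Fin n
      A = suc i
      B = suc (next i)

      C : Subset n
      C = ∁ (⁅ A ⁆ ∪ ⁅ B ⁆)

      ∈C⁺ : ∀ {x} → x ≢ A → x ≢ B → x ∈ C
      ∈C⁺ x≢A x≢B = x∉p⇒x∈∁p ([ x≢A ∘ x∈⁅y⁆⇒x≡y A , x≢B ∘ x∈⁅y⁆⇒x≡y B ] ∘ x∈p∪q⁻ ⁅ A ⁆ ⁅ B ⁆)

      ∈C⁻ : ∀ {x} → x ∈ C → x ≢ A × x ≢ B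
      ∈C⁻ x∈C = (λ { refl → x∈∁p⇒x∉p x∈C (x∈p∪q⁺ (inj₁ (x∈⁅x⁆ A))) })
              , (λ { refl → x∈∁p⇒x∉p x∈C (x∈p∪q⁺ (inj₂ (x∈⁅x⁆ B))) })

      C-betweenClosed : BetweenClosed W C
      C-betweenClosed {w = zero}  _ _ _ = ∈C⁺ (λ ()) (λ ())
      C-betweenClosed {zero}  {suc _} {zero}  _ _ (_ , _ , u≢v , _) = contradiction refl u≢v
      C-betweenClosed {zero}  {suc _} {suc _} _ _ (_ , _ , _ , ¬uv) = contradiction tt ¬uv
      C-betweenClosed {suc _} {suc _} {zero}  _ _ (_ , _ , _ , ¬uv) = contradiction tt ¬uv
      C-betweenClosed {suc u} {suc j} {suc v} u∈C v∈C (uj , jv , u≢v , _) = ∈C⁺ j≢i j≢next-i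
        where
        neighbours : (u ≡ next j × next v ≡ j) ⊎ (next u ≡ j × v ≡ next j)
        neighbours = rim-neighbours uj jv (u≢v ∘ cong suc)
        j≢i : suc j ≢ A
        j≢i refl = [ proj₂ (∈C⁻ u∈C) ∘ cong suc ∘ proj₁
                   , proj₂ (∈C⁻ v∈C) ∘ cong suc ∘ proj₂ ] neighbours
        j≢next-i : suc j ≢ B
        j≢next-i refl = [ proj₁ (∈C⁻ v∈C) ∘ cong suc ∘ next-injective ∘ proj₂
                        , proj₁ (∈C⁻ u∈C) ∘ cong suc ∘ next-injective ∘ proj₁ ] neighbours

    freeRimEdge⇒¬generating : ∀ P → suc i ∉ P → suc (next i) ∉ P → ¬ Generating W P
    freeRimEdge⇒¬generating P A∉P B∉P generating =
      proj₁ (∈C⁻ (generating C (betweenClosed⇒convex W wheel-diameter≤2 C-betweenClosed) P⊆C A)) refl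
      where
      P⊆C : P ⊆ C
      P⊆C x∈P = ∈C⁺ (λ { refl → A∉P x∈P }) (λ { refl → B∉P x∈P })

  meetsRimEdges⇒generating : ∀ P → (∀ i → suc i ∈ P ⊎ suc (next i) ∈ P) → Generating W P
  meetsRimEdges⇒generating P meets C convex P⊆C = ∈C
    where
    closed : BetweenClosed W C
    closed = convex⇒betweenClosed W convex

    rim∈C : ∀ x → suc x ∈ C
    rim∈C x with suc x ∈? P | next-surjective x
    ... | yes x∈P | _        = P⊆C x∈P
    ... | no x∉P  | p , refl =
      closed (P⊆C ([ id , (λ x∈P → contradiction x∈P x∉P) ] (meets p)))
             (P⊆C ([ (λ x∈P → contradiction x∈P x∉P) , id ] (meets (next p))))
             (rim-between p)

    ∈C : ∀ v → v ∈ C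
    ∈C zero    = closed (rim∈C zero) (rim∈C _) (hub-between zero)
    ∈C (suc x) = rim∈C x

  ¬generating⇒freeRimEdge : ∀ P → ¬ Generating W P → Σ (Fin m) λ i → suc i ∉ P × suc (next i) ∉ P
  ¬generating⇒freeRimEdge P ¬generating
    with ¬∀⟶∃¬ m _ (λ i → (suc i ∈? P) ⊎-dec (suc (next i) ∈? P))
               (¬generating ∘ meetsRimEdges⇒generating P)
  ... | i , ¬meets = i , ¬meets ∘ inj₁ , ¬meets ∘ inj₂

  rim-edge-ends-distinct : ∀ i → suc i ≢ suc (next i)
  rim-edge-ends-distinct i = next-irrefl i ∘ sym ∘ suc-injectiveᶠ

  ¬generating⇒2≤unselected : ∀ P → ¬ Generating W P → 2 ≤ unselected P
  ¬generating⇒2≤unselected P ¬generating with ¬generating⇒freeRimEdge P ¬generating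
  ... | i , A∉P , B∉P = 2≤unselected (rim-edge-ends-distinct i) A∉P B∉P

  ¬generating⇒extensible : ∀ P → ¬ Generating W P → 3 ≤ unselected P → Σ (Subset n) (Option W P)
  ¬generating⇒extensible P ¬generating 3≤ with ¬generating⇒freeRimEdge P ¬generating
  ... | i , A∉P , B∉P with ∃-third-unselected (rim-edge-ends-distinct i) A∉P B∉P 3≤
  ... | v , v∉P , A≢v , B≢v =
    P ∪ ⁅ v ⁆ , v , v∉P , refl , freeRimEdge⇒¬generating i _ (∉-∪-⁅⁆ A∉P A≢v) (∉-∪-⁅⁆ B∉P B≢v)

  nimDNG-wheel : NimDNG W (parity (3 + k))
  nimDNG-wheel = hasNim-parity W ¬generating⇒2≤unselected ¬generating⇒extensible (3 + k) ⊥
                   (freeRimEdge⇒¬generating zero ⊥ ∉⊥ ∉⊥) (unselected-⊥ n)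

proposition7p24 : ∀ (n : ℕ) → 5 ≤ n → NimDNG (Wheel n) (pty n)
proposition7p24 n 5≤n with m≤n⇒∃[o]m+o≡n 5≤n
... | k , refl = subst (NimDNG (Wheel (5 + k))) (parity≡%2 (5 + k)) (WheelGame.nimDNG-wheel k)
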